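{- Let $n\ge4$ and $A\in\mathbb{Z}^{n\times n}$. Then $A=B+C+F$, where $B\in\mathbb{Z}^{n\times n}$ is a matrix all of whose off-diagonal pairs $(B_{ij},B_{ji})$, $i\ne j$, belong to $\Phi(A)$; $C\in\mathbb{Z}^{n\times n}$ is a matrix whose entries are constant above the main diagonal and constant below the main diagonal; and $F=[f_i^++f_j^-]_{i,j}$ for some integers $f_1^+,\dots,f_n^+,f_1^-,\dots,f_n^-$.
   Context: For $\sigma\in S_n$, $(A^\sigma)_{ij}=A_{\sigma(i)\sigma(j)}$. The primitivity lattice $\Phi(A)\subseteq\mathbb{Z}^2$ is the $\mathbb{Z}$-module generated by the pairs $\big((A^\pi)_{13}-(A^\pi)_{23}-(A^\pi)_{14}+(A^\pi)_{24},\ (A^\pi)_{31}-(A^\pi)_{32}-(A^\pi)_{41}+(A^\pi)_{42}\big)$ for $\pi\in S_n$. -}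

module Defs where

open import Data.Nat using (ℕ; suc; zero; s≤s; z≤n) renaming (_≤_ to _≤ℕ_)
open import Data.Nat.Properties using (≤-trans)
open import Data.Fin using (Fin; fromℕ<)
open import Data.Fin.Permutation using (Permutation′; _⟨$⟩ʳ_)
open import Data.Integer using (ℤ; _+_; _-_; -_; 0ℤ)
open import Data.Product using (_×_; _,_)

Matrix : ℕ → Set
Matrix n = Fin n → Fin n → ℤ

_^σ_ : ∀ {n} → Matrix n → Permutation′ n → Matrix n
(A ^σ σ) i j = A (σ ⟨$⟩ʳ i) (σ ⟨$⟩ʳ j)

-- the (0-based) indices 1,2,3,4 of Fin n, given n ≥ 4
module Idx {n : ℕ} (h : 4 ≤ℕ n) where
  i1 i2 i3 i4 : Fin n
  i1 = fromℕ< (≤-trans (s≤s z≤n) h)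
  i2 = fromℕ< (≤-trans (s≤s (s≤s z≤n)) h)
  i3 = fromℕ< (≤-trans (s≤s (s≤s (s≤s z≤n))) h)
  i4 = fromℕ< h

gen : ∀ {n} → 4 ≤ℕ n → Matrix n → Permutation′ n → ℤ × ℤ
gen h A π =
  ( (P i1 i3 - P i2 i3) - P i1 i4 + P i2 i4
  , (P i3 i1 - P i3 i2) - P i4 i1 + P i4 i2 )
  where
  open Idx h
  P : Matrix _
  P = A ^σ π

data Φ {n : ℕ} (h : 4 ≤ℕ n) (A : Matrix n) : ℤ × ℤ → Set where
  φ-zero : Φ h A (0ℤ , 0ℤ)
  φ-gen  : ∀ π → Φ h A (gen h A π)
  φ-add  : ∀ {a b c d} → Φ h A (a , b) → Φ h A (c , d) → Φ h A (a + c , b + d)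
  φ-neg  : ∀ {a b} → Φ h A (a , b) → Φ h A (- a , - b)

-- Fix the index r = 1 and put Ã i j = A i j − A i r − A r j, so that A is Ã plus a matrix of
-- the form f⁺ i + f⁻ j.  For pairwise distinct a, b, c, d some permutation maps 1, 2, 3, 4 to
-- them, so the cross difference A a c − A b c − A a d + A b d, paired with its transpose, lies
-- in Φ(A).  Such cross differences are exactly the differences between the pairs (Ã a j , Ã j a)
-- that share an index, and since n ≥ 4 leaves three indices besides r, all pairs with
-- a ≠ j, both different from r, are congruent modulo Φ(A).  Subtracting one such pair above
-- the diagonal and its transpose below the diagonal therefore leaves entries with off-diagonal
-- pairs in Φ(A); the row and column r are absorbed by adjusting f⁺ r and f⁻ r.
module Submission where

open import Defs
open import Data.Nat using (ℕ; s≤s; z<s) renaming (_≤_ to _≤ℕ_; _+_ to _+ℕ_)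
open import Data.Fin using (Fin; zero; suc; _<_; _≟_; _<?_)
open import Data.Fin.Properties using (<-cmp; <-asym)
open import Data.Fin.Permutation using (Permutation′; _⟨$⟩ʳ_; transpose; _∘ₚ_)
open import Data.Integer using (ℤ; _+_; _-_; -_; 0ℤ)
open import Data.Integer.Properties using (+-inverseʳ)
open import Data.Integer.Tactic.RingSolver using (solve-∀)
open import Data.Product using (Σ; _×_; _,_; proj₁; proj₂)
open import Data.Empty using (⊥-elim)
open import Function.Base using (_$_)
open import Function.Bundles using (Injection)
open import Function.Properties.Inverse using (↔⇒↣)
open import Relation.Nullary using (yes; no)
open import Relation.Binary.Definitions using (tri<; tri≈; tri>)
open import Relation.Binary.PropositionalEquality
  using (_≡_; _≢_; refl; sym; ≢-sym)

module _ {n : ℕ} where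

  transpose-sends : (i j : Fin n) → transpose i j ⟨$⟩ʳ i ≡ j
  transpose-sends i j with i ≟ i
  ... | yes _   = refl
  ... | no i≢i = ⊥-elim (i≢i refl)

  transpose-fixes : (i j k : Fin n) → k ≢ i → k ≢ j → transpose i j ⟨$⟩ʳ k ≡ k
  transpose-fixes i j k k≢i k≢j with k ≟ i
  ... | yes k≡i = ⊥-elim (k≢i k≡i)
  ... | no _ with k ≟ j
  ...   | yes k≡j = ⊥-elim (k≢j k≡j)
  ...   | no _    = refl

  redirect : Permutation′ n → Fin n → Fin n → Permutation′ n
  redirect π k t = π ∘ₚ transpose (π ⟨$⟩ʳ k) t

  redirect-sends : (π : Permutation′ n) (k t : Fin n) → redirect π k t ⟨$⟩ʳ k ≡ t
  redirect-sends π k t = transpose-sends (π ⟨$⟩ʳ k) t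

  redirect-keeps : (π : Permutation′ n) (k t x : Fin n) {s : Fin n} →
                   π ⟨$⟩ʳ x ≡ s → x ≢ k → s ≢ t → redirect π k t ⟨$⟩ʳ x ≡ s
  redirect-keeps π k t x {s} refl x≢k s≢t =
    transpose-fixes (π ⟨$⟩ʳ k) t s (λ πx≡πk → x≢k (Injection.injective (↔⇒↣ π) πx≡πk)) s≢t

_⊖_ : ℤ × ℤ → ℤ × ℤ → ℤ × ℤ
p ⊖ q = (proj₁ p - proj₁ q , proj₂ p - proj₂ q)

cross : ∀ {n} → Matrix n → (a b c d : Fin n) → ℤ × ℤ
cross A a b c d = ((A a c - A b c) - A a d + A b d , (A c a - A c b) - A d a + A d b)

module Modulo-Φ {n : ℕ} (h : 4 ≤ℕ n) (A : Matrix n) where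

  Φ-resp : ∀ {a b c d} → a ≡ c → b ≡ d → Φ h A (a , b) → Φ h A (c , d)
  Φ-resp refl refl p = p

  infix 4 _∼_
  record _∼_ (p q : ℤ × ℤ) : Set where
    constructor by-Φ
    field difference∈Φ : Φ h A (p ⊖ q)

  open _∼_ public

  ∼-refl : ∀ p → p ∼ p
  ∼-refl (a , b) = by-Φ (Φ-resp (sym (+-inverseʳ a)) (sym (+-inverseʳ b)) φ-zero)

  ∼-trans : ∀ {p q s} → p ∼ q → q ∼ s → p ∼ s
  ∼-trans {a , b} {c , d} {e , f} (by-Φ p∼q) (by-Φ q∼s) =
    by-Φ (Φ-resp (telescope a c e) (telescope b d f) (φ-add p∼q q∼s))
    where
    telescope : ∀ x y z → (x - y) + (y - z) ≡ x - z
    telescope = solve-∀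

-- On Fin (4 + m) the indices i1 … i4 of Idx compute to 0F … 3F, so their distinctness is λ ().
module Decomposition {m : ℕ} (h : 4 ≤ℕ 4 +ℕ m) (A : Matrix (4 +ℕ m)) where

  open Idx h
  open Modulo-Φ h A

  Index : Set
  Index = Fin (4 +ℕ m)

  gen∈Φ : (π : Permutation′ (4 +ℕ m)) {a b c d : Index} →
          π ⟨$⟩ʳ i1 ≡ a → π ⟨$⟩ʳ i2 ≡ b → π ⟨$⟩ʳ i3 ≡ c → π ⟨$⟩ʳ i4 ≡ d → Φ h A (cross A a b c d)
  gen∈Φ π refl refl refl refl = φ-gen π

  cross∈Φ : {a b c d : Index} → a ≢ b → a ≢ c → a ≢ d → b ≢ c → b ≢ d → c ≢ d →
            Φ h A (cross A a b c d)
  cross∈Φ {a} {b} {c} {d} a≢b a≢c a≢d b≢c b≢d c≢d = gen∈Φ π₄ π₄a π₄b π₄c π₄d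
    where
    π₁ π₂ π₃ π₄ : Permutation′ (4 +ℕ m)
    π₁ = transpose i1 a
    π₂ = redirect π₁ i2 b
    π₃ = redirect π₂ i3 c
    π₄ = redirect π₃ i4 d
    π₄a : π₄ ⟨$⟩ʳ i1 ≡ a
    π₄a = redirect-keeps π₃ i4 d i1
            (redirect-keeps π₂ i3 c i1 (redirect-keeps π₁ i2 b i1 (transpose-sends i1 a) (λ ()) a≢b) (λ ()) a≢c)
            (λ ()) a≢d
    π₄b : π₄ ⟨$⟩ʳ i2 ≡ b
    π₄b = redirect-keeps π₃ i4 d i2 (redirect-keeps π₂ i3 c i2 (redirect-sends π₁ i2 b) (λ ()) b≢c) (λ ()) b≢d
    π₄c : π₄ ⟨$⟩ʳ i3 ≡ c
    π₄c = redirect-keeps π₃ i4 d i3 (redirect-sends π₂ i3 c) (λ ()) c≢d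
    π₄d : π₄ ⟨$⟩ʳ i4 ≡ d
    π₄d = redirect-sends π₃ i4 d

  r : Index
  r = i1

  Ã : Matrix (4 +ℕ m)
  Ã i j = A i j - A i r - A r j

  Ã-pair : Index → Index → ℤ × ℤ
  Ã-pair a j = (Ã a j , Ã j a)

  Ã-pair-moveˡ : ∀ {a b j} → a ≢ j → b ≢ j → a ≢ r → b ≢ r → j ≢ r → Ã-pair a j ∼ Ã-pair b j
  Ã-pair-moveˡ {a} {b} {j} a≢j b≢j a≢r b≢r j≢r with a ≟ b
  ... | yes refl = ∼-refl (Ã-pair a j)
  ... | no a≢b   = by-Φ $
    Φ-resp (first (A a j) (A b j) (A a r) (A b r) (A r j)) (second (A j a) (A j b) (A r a) (A r b) (A j r))
      (cross∈Φ a≢b a≢j a≢r b≢j b≢r j≢r)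
    where
    first : ∀ x y u v w → (x - y) - u + v ≡ (x - u - w) - (y - v - w)
    first = solve-∀
    second : ∀ x y u v w → (x - y) - u + v ≡ (x - w - u) - (y - w - v)
    second = solve-∀

  Ã-pair-moveʳ : ∀ {a j k} → a ≢ j → a ≢ k → a ≢ r → j ≢ r → k ≢ r → Ã-pair a j ∼ Ã-pair a k
  Ã-pair-moveʳ {a} {j} {k} a≢j a≢k a≢r j≢r k≢r with j ≟ k
  ... | yes refl = ∼-refl (Ã-pair a j)
  ... | no j≢k   = by-Φ $
    Φ-resp (first (A a j) (A r j) (A a k) (A r k) (A a r)) (second (A j a) (A j r) (A k a) (A k r) (A r a))
      (cross∈Φ a≢r a≢j a≢k (≢-sym j≢r) (≢-sym k≢r) j≢k)
    where
    first : ∀ x y u v w → (x - y) - u + v ≡ (x - w - y) - (u - w - v)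
    first = solve-∀
    second : ∀ x y u v w → (x - y) - u + v ≡ (x - y - w) - (u - v - w)
    second = solve-∀

  fresh-besides-i2 : (y : Index) → Σ Index λ c → c ≢ r × c ≢ i2 × c ≢ y
  fresh-besides-i2 y with i3 ≟ y
  ... | yes refl = i4 , (λ ()) , (λ ()) , (λ ())
  ... | no i3≢y  = i3 , (λ ()) , (λ ()) , i3≢y

  fresh : (x y : Index) → Σ Index λ c → c ≢ r × c ≢ x × c ≢ y
  fresh x y with i2 ≟ x | i2 ≟ y
  ... | no i2≢x | no i2≢y = i2 , (λ ()) , i2≢x , i2≢y
  ... | yes refl | _       = fresh-besides-i2 y
  ... | no _     | yes refl with fresh-besides-i2 x
  ...   | c , c≢r , c≢i2 , c≢x = c , c≢r , c≢x , c≢i2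

  Ã-pairs-∼ : ∀ {a j b k} → a ≢ j → a ≢ r → j ≢ r → b ≢ k → b ≢ r → k ≢ r → Ã-pair a j ∼ Ã-pair b k
  Ã-pairs-∼ {a} {j} {b} {k} a≢j a≢r j≢r b≢k b≢r k≢r with a ≟ k
  ... | no a≢k = ∼-trans (Ã-pair-moveʳ a≢j a≢k a≢r j≢r k≢r) (Ã-pair-moveˡ a≢k b≢k a≢r b≢r k≢r)
  ... | yes refl with fresh a j
  ...   | c , c≢r , c≢a , c≢j =
    ∼-trans (Ã-pair-moveˡ a≢j c≢j a≢r c≢r j≢r)
      (∼-trans (Ã-pair-moveʳ c≢j c≢a c≢r j≢r a≢r) (Ã-pair-moveˡ c≢a b≢k c≢r b≢r a≢r))

  cu cl : ℤ
  cu = Ã i2 i3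
  cl = Ã i3 i2

  C : Matrix (4 +ℕ m)
  C i j with i <? j
  ... | yes _ = cu
  ... | no _  = cl

  C-above : ∀ i j → i < j → C i j ≡ cu
  C-above i j i<j with i <? j
  ... | yes _   = refl
  ... | no i≮j = ⊥-elim (i≮j i<j)

  C-below : ∀ i j → j < i → C i j ≡ cl
  C-below i j j<i with i <? j
  ... | yes i<j = ⊥-elim (<-asym i<j j<i)
  ... | no _    = refl

  fplus fminus : Index → ℤ
  fplus zero      = - cu
  fplus i@(suc _) = A i r
  fminus zero      = - cl
  fminus j@(suc _) = A r j

  B : Matrix (4 +ℕ m)
  B i j = A i j - C i j - (fplus i + fminus j)

  A≡B+C+F : ∀ i j → A i j ≡ B i j + C i j + (fplus i + fminus j)
  A≡B+C+F i j = identity (A i j) (C i j) (fplus i + fminus j)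
    where
    identity : ∀ a c f → a ≡ (a - c - f) + c + f
    identity = solve-∀

  B-row-r : (j : Fin (3 +ℕ m)) → B r (suc j) ≡ 0ℤ
  B-row-r j rewrite C-above r (suc j) z<s = cancel (A r (suc j)) cu
    where
    cancel : ∀ x c → x - c - (- c + x) ≡ 0ℤ
    cancel = solve-∀

  B-column-r : (i : Fin (3 +ℕ m)) → B (suc i) r ≡ 0ℤ
  B-column-r i rewrite C-below (suc i) r z<s = cancel (A (suc i) r) cl
    where
    cancel : ∀ x c → x - c - (x + - c) ≡ 0ℤ
    cancel = solve-∀

  B-off-r : ∀ {c} (i j : Fin (3 +ℕ m)) → C (suc i) (suc j) ≡ c → B (suc i) (suc j) ≡ Ã (suc i) (suc j) - c
  B-off-r i j refl = regroup (A (suc i) (suc j)) (C (suc i) (suc j)) (A (suc i) r) (A r (suc j))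
    where
    regroup : ∀ x c u v → x - c - (u + v) ≡ (x - u - v) - c
    regroup = solve-∀

  B-pair∈Φ : ∀ i j → i ≢ j → Φ h A (B i j , B j i)
  B-pair∈Φ zero    zero    0≢0 = ⊥-elim (0≢0 refl)
  B-pair∈Φ zero    (suc j) _   = Φ-resp (sym (B-row-r j)) (sym (B-column-r j)) φ-zero
  B-pair∈Φ (suc i) zero    _   = Φ-resp (sym (B-column-r i)) (sym (B-row-r i)) φ-zero
  B-pair∈Φ (suc i) (suc j) i≢j with <-cmp (suc i) (suc j)
  ... | tri≈ _ i≡j _ = ⊥-elim (i≢j i≡j)
  ... | tri< i<j _ _ =
    Φ-resp (sym (B-off-r i j (C-above _ _ i<j))) (sym (B-off-r j i (C-below _ _ i<j)))
      (difference∈Φ (Ã-pairs-∼ i≢j (λ ()) (λ ()) (λ ()) (λ ()) (λ ())))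
  ... | tri> _ _ j<i =
    Φ-resp (sym (B-off-r i j (C-below _ _ j<i))) (sym (B-off-r j i (C-above _ _ j<i)))
      (difference∈Φ (Ã-pairs-∼ i≢j (λ ()) (λ ()) (λ ()) (λ ()) (λ ())))

lemma4p1 : (n : ℕ) (h : 4 ≤ℕ n) (A : Matrix n) →
    Σ (Matrix n) λ B → Σ (Matrix n) λ C → Σ (Fin n → ℤ) λ fplus → Σ (Fin n → ℤ) λ fminus →
      ((i j : Fin n) → i ≢ j → Φ h A (B i j , B j i))
      × (Σ ℤ λ cu → Σ ℤ λ cl → ((i j : Fin n) → i < j → C i j ≡ cu) × ((i j : Fin n) → j < i → C i j ≡ cl))
      × ((i j : Fin n) → A i j ≡ B i j + C i j + (fplus i + fminus j))
lemma4p1 _ h@(s≤s (s≤s (s≤s (s≤s _)))) A =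
  B , C , fplus , fminus , B-pair∈Φ ,
  (cu , cl , C-above , C-below) , A≡B+C+F
  where open Decomposition h A
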